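{- Let $G=(V,E,b,c)$ be a weighted hypergraph (every vertex lying in some edge) processed by procedure COVER (described in the context), and let $\mathtt{OPT}$ be a minimum-cost edge cover of $G$. Let $0<\epsilon<1$ and let $r^*$ be the largest integer such that $b(I(\le r^*))\le\epsilon\cdot b(V)$, where $I(\le r)=\{v\in V\mid\mathrm{eff}_\infty(v)\le r\}$. Then the edge collection $S(>r^*)=\{e\in E\mid \exists v\in V \text{ with } \mathrm{eff}_\infty(v)>r^* \text{ and } \mathrm{eid}_\infty(v)=\mathrm{id}(e)\}$ satisfies $$c(S(>r^*)) < 8\cdot c(\mathtt{OPT})/\epsilon.$$
   Context: A weighted hypergraph $G=(V,E,b,c)$: finite vertex set $V$, multiset $E$ of nonempty subsets of $V$, every vertex in at least one edge, $b:V\to\mathbb{Q}_{>0}$, $c:E\to\mathbb{Q}_{>0}$, $b(U)=\sum_{v\in U}b(v)$, $c(F)=\sum_{e\in F}c(e)$; an edge cover is $F\subseteq E$ whose union is $V$. Edges arrive as a stream $e_0,\dots,e_{m-1}$ with $\mathrm{id}(e_t)=t$. $\lg$ = log base 2. Procedure COVER keeps for each $v\in V$ a value $\mathrm{eid}(v)$ (initially NULL) and $\mathrm{eff}(v)\in\mathbb{Z}\cup\{ -\infty\}$ (initially $-\infty$); $\mathrm{eff}_t(v)$ denotes the value just before $e_t$ is processed, and $\mathrm{eid}_\infty(v),\mathrm{eff}_\infty(v)$ the final values. For $T\subseteq e_t$, $\mathrm{lev}_t(T)=\lceil\lg(b(T)/c(e_t))\rceil$; $T$ is effective at time $t$ if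 $\mathrm{lev}_t(T)>\mathrm{eff}_t(v)$ for every $v\in T$ ($\emptyset$ is vacuously effective). At time $t$, COVER computes an effective subset $T\subseteq e_t$ of largest benefit $b(T)$ and sets $\mathrm{eid}(v)\leftarrow\mathrm{id}(e_t)$ and $\mathrm{eff}(v)\leftarrow\mathrm{lev}_t(T)$ for all $v\in T$.
   Formalization: The parameter ε ranges only over rational numbers strictly between 0 and 1. -}

module Defs where

open import Data.Nat as ℕ using (ℕ; zero; suc)
open import Data.Fin using (Fin; zero; suc; fromℕ<)
open import Data.Fin.Subset using (Subset; _∈_; _⊆_; Empty; Nonempty; inside; outside)
open import Data.Bool using (Bool; true; false; if_then_else_)
open import Data.Vec using (Vec; []; _∷_; lookup; tabulate)
open import Data.Integer as ℤ using (ℤ; +_; -[1+_])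
open import Data.Rational as ℚ using (ℚ; 0ℚ; 1ℚ; _+_; _*_; _≤_; _<_)
open import Data.Maybe using (Maybe; just; nothing)
open import Data.Product using (Σ; ∃; _×_; _,_)
open import Data.Sum using (_⊎_)
open import Data.Unit using (⊤)
open import Data.Empty using (⊥)
open import Relation.Binary.PropositionalEquality using (_≡_)
open import Relation.Nullary using (does; _×-dec_)
open import Relation.Nullary.Decidable using (⌊_⌋)
open import Data.Fin.Properties using (any?)
open import Data.Maybe.Properties using (≡-dec)
import Data.Fin.Properties as FinP

sumOver : ∀ {k} → (Fin k → ℚ) → Subset k → ℚ
sumOver {zero}  w []            = 0ℚ
sumOver {suc k} w (inside  ∷ p) = w zero + sumOver (λ i → w (suc i)) p
sumOver {suc k} w (outside ∷ p) = sumOver (λ i → w (suc i)) p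

full : ∀ k → Subset k
full k = tabulate (λ _ → inside)

half : ℚ
half = + 1 ℚ./ 2

two : ℚ
two = + 2 ℚ./ 1

iter : ℕ → ℚ → ℚ → ℚ
iter zero    a x = x
iter (suc k) a x = a * iter k a x

pow2 : ℤ → ℚ
pow2 (+ k)    = iter k two 1ℚ
pow2 -[1+ k ] = iter (suc k) half 1ℚ

-- IsCeilLg q c k  :⇔  k = ⌈ lg (q / c) ⌉   (for q, c > 0),
-- i.e.  2^(k-1) < q / c ≤ 2^k, written multiplicatively since c > 0.
IsCeilLg : ℚ → ℚ → ℤ → Set
IsCeilLg q c k = (pow2 (k ℤ.- ℤ.+ 1) * c < q) × (q ≤ pow2 k * c)

record Hypergraph : Set where
  field
    n        : ℕ
    m        : ℕ                    -- number of edges; id(e_t) = t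
    edge     : Fin m → Subset n     -- E as a multiset, indexed by arrival time
    b        : Fin n → ℚ
    c        : Fin m → ℚ
    b-pos    : ∀ v → 0ℚ < b v
    c-pos    : ∀ e → 0ℚ < c e
    edge-ne  : ∀ e → Nonempty (edge e)
    covered  : ∀ v → ∃ λ e → v ∈ edge e

module _ (G : Hypergraph) where
  open Hypergraph G

  bOf : Subset n → ℚ
  bOf = sumOver b

  cOf : Subset m → ℚ
  cOf = sumOver c

  IsEdgeCover : Subset m → Set
  IsEdgeCover F = ∀ v → ∃ λ e → e ∈ F × v ∈ edge e

  IsMinEdgeCover : Subset m → Set
  IsMinEdgeCover F = IsEdgeCover F × (∀ F' → IsEdgeCover F' → cOf F ≤ cOf F')

  -- state of COVER: eid(v) ∈ {NULL} ∪ ids, eff(v) ∈ ℤ ∪ {-∞} (nothing = -∞)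
  record State : Set where
    constructor state
    field
      eid : Fin n → Maybe (Fin m)
      eff : Fin n → Maybe ℤ

  initial : State
  initial = state (λ _ → nothing) (λ _ → nothing)

  _<∞_ : Maybe ℤ → ℤ → Set
  nothing <∞ k = ⊤
  just x  <∞ k = x ℤ.< k

  -- T ⊆ e_t is effective at time t with level k = lev_t(T) (∅ is vacuously effective)
  EffectiveAt : State → Fin m → Subset n → ℤ → Set
  EffectiveAt s t T k =
    Empty T ⊎ (IsCeilLg (bOf T) (c t) k × (∀ v → v ∈ T → State.eff s v <∞ k))

  Effective : State → Fin m → Subset n → Set
  Effective s t T = ∃ λ k → EffectiveAt s t T k

  ValidChoice : State → Fin m → Subset n → ℤ → Set
  ValidChoice s t T k =
    T ⊆ edge t × EffectiveAt s t T k ×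
    (∀ T' → T' ⊆ edge t → Effective s t T' → bOf T' ≤ bOf T)

  update : State → Fin m → Subset n → ℤ → State
  update (state ei ef) t T k =
    state (λ v → if lookup T v then just t else ei v)
          (λ v → if lookup T v then just k else ef v)

  -- Reach t s : after processing e_0 … e_{t-1}, COVER can be in state s
  data Reach : ℕ → State → Set where
    start : Reach 0 initial
    step  : ∀ {t s} → Reach t s → (p : t ℕ.< m) → (T : Subset n) → (k : ℤ) →
            ValidChoice s (fromℕ< p) T k →
            Reach (suc t) (update s (fromℕ< p) T k)

  FinalState : State → Set
  FinalState s = Reach m s

  leq∞ : Maybe ℤ → ℤ → Bool
  leq∞ nothing  r = true
  leq∞ (just x) r = ⌊ x ℤ.≤? r ⌋

  gt∞ : Maybe ℤ → ℤ → Bool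
  gt∞ nothing  r = false
  gt∞ (just x) r = ⌊ r ℤ.<? x ⌋

  Ile : State → ℤ → Subset n
  Ile s r = tabulate (λ v → leq∞ (State.eff s v) r)

  Sgt : State → ℤ → Subset m
  Sgt s r = tabulate (λ e → ⌊ any? (λ v →
              Data.Bool._≟_ (gt∞ (State.eff s v) r) true ×-dec
              ≡-dec FinP._≟_ (State.eid s v) (just e)) ⌋)
    where import Data.Bool

eight : ℚ
eight = + 8 ℚ./ 1

-- Fix r.  Give each vertex at level x the potential b(v)·max(0, 2 − 2^(r+1−x)) (and 0 at −∞).
-- When COVER picks T ⊆ e_t at a level k > r, every vertex of T was below k, so the potential
-- grows by at least 2^(r+1−k)·b(T) > 2^r·c(e_t), because 2^(k−1)·c(e_t) < b(T).
-- Only such steps add edges to S(>r), and the potential never exceeds 2·b(V); hence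
-- 2^r·c(S(>r)) ≤ 2·b(V).
--
-- Conversely b(o ∩ I(≤R)) ≤ 2^R·c(o) for every edge o.  Otherwise, when o arrived and COVER
-- chose T, the set T ∪ (o ∩ I(≤R)) was effective (its level exceeds both R and that of T),
-- so maximality of T forces o ∩ I(≤R) ⊆ T; but these vertices then got level lev(T) > R.
-- Summing over a cover gives b(I(≤R)) ≤ 2^R·c(OPT).  Taking R = r + 1, maximality of r yields
-- ε·b(V) < 2^(r+1)·c(OPT), and together with the first bound ε·c(S(>r)) < 4·c(OPT).

module Submission where

open import Defs
open import Data.Fin.Subset using (Subset)
open import Data.Integer using (ℤ)
import Data.Integer
open import Data.Rational using (ℚ; 0ℚ; 1ℚ; _*_; _÷_; _≤_; _<_; positive)
open import Data.Rational.Properties using (pos⇒nonZero)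
open import Data.Product using (_×_)

open import Algebra.Bundles using (Ring; CommutativeRing)
import Algebra.Properties.CommutativeSemigroup as CommutativeSemigroupProperties
open import Data.Bool using (true; false; if_then_else_)
open import Data.Bool.Properties using (T-≡)
open import Data.Empty using (⊥; ⊥-elim)
open import Data.Fin using (Fin; zero; suc; toℕ; fromℕ<)
import Data.Fin.Properties as FinP
open import Data.Fin.Subset using (_∈_; _∉_; _⊆_; _∪_; _∩_; ⁅_⁆; Empty; Nonempty; inside; outside)
  renaming (⊥ to ∅)
open import Data.Fin.Subset.Properties
  using (_∈?_; x∈p∪q⁻; x∈p∪q⁺; x∈p∩q⁻; x∈p∩q⁺; p⊆p∪q; q⊆p∪q; x∈⁅x⁆; x∈⁅y⁆⇒x≡y; Empty-unique)
open import Data.Integer using (+_; -[1+_]; 1ℤ; -1ℤ)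
import Data.Integer as ℤ
import Data.Integer.Properties as ℤP
open import Data.Integer.Tactic.RingSolver using (solve-∀)
open import Data.Maybe using (Maybe; just; nothing)
open import Data.Maybe.Properties using (just-injective)
open import Data.Nat using (ℕ; zero; suc)
import Data.Nat as ℕ
import Data.Nat.Properties as ℕP
open import Data.Product using (∃; _,_; proj₁; proj₂)
open import Data.Rational
  using (_+_; _-_; _⊔_; Positive; NonZero; nonNegative; mkℚ; toℚᵘ; 1/_; ↥_)
import Data.Rational.Properties as ℚP
open import Data.Rational.Solver using (module +-*-Solver)
open +-*-Solver using (solve; _:+_; _:-_; _:*_; _:=_; con)
import Data.Rational.Unnormalised as ℚᵘ
import Data.Rational.Unnormalised.Properties as ℚᵘP
open import Data.Sum using (_⊎_; inj₁; inj₂; [_,_]′)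
open import Data.Vec using ([]; _∷_; lookup; tabulate; here; there)
open import Data.Vec.Properties using ([]=⇒lookup; lookup⇒[]=; lookup∘tabulate)
open import Function using (_∘_; id)
open import Function.Bundles using (Equivalence)
open import Relation.Binary.Construct.Add.Infimum.NonStrict ℤ._≤_
  using (_≤₋_; ⊥₋≤_; [_]; [≤]-injective; ≤₋-isPreorder-≡)
open import Relation.Binary.PropositionalEquality
open import Relation.Binary.Structures using (IsPreorder)
open import Relation.Nullary using (yes; no; contradiction)
open import Relation.Nullary.Decidable using (Dec; ⌊_⌋; toWitness; fromWitness)

open import Algebra.Properties.Semiring.Sum (Ring.semiring ℚP.+-*-ring)
  using (sum; ∑-comm; ∑-distrib-+; *-distribˡ-sum; sum-replicate-zero; sum-cong-≗)
open CommutativeSemigroupProperties ℤP.+-commutativeSemigroup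
  using () renaming (x∙yz≈y∙xz to +-leftComm)
open CommutativeSemigroupProperties (CommutativeRing.*-commutativeSemigroup ℚP.+-*-commutativeRing)
  using () renaming (x∙yz≈y∙xz to *-leftComm)

module _ {a} {A : Set a} {k} {p : Subset k} {i : Fin k} {x y : A} where

  if-∈ : i ∈ p → (if lookup p i then x else y) ≡ x
  if-∈ i∈p rewrite []=⇒lookup i∈p = refl

  if-∉ : i ∉ p → (if lookup p i then x else y) ≡ y
  if-∉ i∉p with lookup p i in eq
  ... | true  = contradiction (lookup⇒[]= i p eq) i∉p
  ... | false = refl

module _ {k p} {P : Fin k → Set p} (P? : ∀ i → Dec (P i)) {i : Fin k} where

  ∈-tabulate-⌊⌋⁻ : i ∈ tabulate (λ j → ⌊ P? j ⌋) → P i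
  ∈-tabulate-⌊⌋⁻ i∈ = toWitness (Equivalence.from T-≡ (trans (sym (lookup∘tabulate _ i)) ([]=⇒lookup i∈)))

  ∈-tabulate-⌊⌋⁺ : P i → i ∈ tabulate (λ j → ⌊ P? j ⌋)
  ∈-tabulate-⌊⌋⁺ Pi = lookup⇒[]= i _ (trans (lookup∘tabulate _ i) (Equivalence.to T-≡ (fromWitness Pi)))

sum-mono-≤ : ∀ {k} {f g : Fin k → ℚ} → (∀ i → f i ≤ g i) → sum f ≤ sum g
sum-mono-≤ {zero}  _   = ℚP.≤-refl
sum-mono-≤ {suc k} f≤g = ℚP.+-mono-≤ (f≤g zero) (sum-mono-≤ (f≤g ∘ suc))

sum-nonNeg : ∀ {k} {f : Fin k → ℚ} → (∀ i → 0ℚ ≤ f i) → 0ℚ ≤ sum f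
sum-nonNeg {k} {f} 0≤f = subst (_≤ sum f) (sum-replicate-zero k) (sum-mono-≤ 0≤f)

p≤p+q : ∀ {p q} → 0ℚ ≤ q → p ≤ p + q
p≤p+q {p} 0≤q = subst (_≤ p + _) (ℚP.+-identityʳ p) (ℚP.+-monoʳ-≤ p 0≤q)

p≤q+p : ∀ {p q} → 0ℚ ≤ q → p ≤ q + p
p≤q+p {p} {q} 0≤q = subst (p ≤_) (ℚP.+-comm p q) (p≤p+q 0≤q)

≤-sum : ∀ {k} {f : Fin k → ℚ} → (∀ i → 0ℚ ≤ f i) → ∀ j → f j ≤ sum f
≤-sum 0≤f zero    = p≤p+q (sum-nonNeg (0≤f ∘ suc))
≤-sum 0≤f (suc j) = ℚP.≤-trans (≤-sum (0≤f ∘ suc) j) (p≤q+p (0≤f zero))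

sum-if : ∀ {k} β (f : Fin k → ℚ) → sum (λ i → if β then f i else 0ℚ) ≡ (if β then sum f else 0ℚ)
sum-if {k} true  f = refl
sum-if {k} false f = sum-replicate-zero k

infixl 10 _↾_

_↾_ : ∀ {k} → (Fin k → ℚ) → Subset k → Fin k → ℚ
(w ↾ p) i = if lookup p i then w i else 0ℚ

module _ {k} (w : Fin k → ℚ) {p : Subset k} {i : Fin k} where

  ↾-∈ : i ∈ p → (w ↾ p) i ≡ w i
  ↾-∈ = if-∈

  ↾-∉ : i ∉ p → (w ↾ p) i ≡ 0ℚ
  ↾-∉ = if-∉

↾-nonNeg : ∀ {k} {w : Fin k → ℚ} → (∀ i → 0ℚ ≤ w i) → ∀ p i → 0ℚ ≤ (w ↾ p) i
↾-nonNeg 0≤w p i with lookup p i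
... | true  = 0≤w i
... | false = ℚP.≤-refl

sumOver-↾ : ∀ {k} (w : Fin k → ℚ) p → sumOver w p ≡ sum (w ↾ p)
sumOver-↾ {zero}  w []            = refl
sumOver-↾ {suc k} w (inside  ∷ p) = cong (λ s → w zero + s) (sumOver-↾ (w ∘ suc) p)
sumOver-↾ {suc k} w (outside ∷ p) = trans (sumOver-↾ (w ∘ suc) p) (sym (ℚP.+-identityˡ _))

module _ {k} {w : Fin k → ℚ} where

  sumOver-+ : ∀ p q → sumOver w p + sumOver w q ≡ sum (λ i → (w ↾ p) i + (w ↾ q) i)
  sumOver-+ p q = trans (cong₂ _+_ (sumOver-↾ w p) (sumOver-↾ w q)) (sym (∑-distrib-+ (w ↾ p) (w ↾ q)))

  sumOver-nonNeg : (∀ i → 0ℚ ≤ w i) → ∀ p → 0ℚ ≤ sumOver w p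
  sumOver-nonNeg 0≤w p = subst (0ℚ ≤_) (sym (sumOver-↾ w p)) (sum-nonNeg (↾-nonNeg 0≤w p))

  ↾-mono-⊆ : (∀ i → 0ℚ ≤ w i) → ∀ {p q} → p ⊆ q → ∀ i → (w ↾ p) i ≤ (w ↾ q) i
  ↾-mono-⊆ 0≤w {p} {q} p⊆q i with i ∈? p
  ... | yes i∈p = ℚP.≤-reflexive (trans (↾-∈ w i∈p) (sym (↾-∈ w (p⊆q i∈p))))
  ... | no  i∉p = subst (_≤ (w ↾ q) i) (sym (↾-∉ w i∉p)) (↾-nonNeg 0≤w q i)

  sumOver-mono-⊆ : (∀ i → 0ℚ ≤ w i) → ∀ {p q} → p ⊆ q → sumOver w p ≤ sumOver w q
  sumOver-mono-⊆ 0≤w {p} {q} p⊆q =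
    subst₂ _≤_ (sym (sumOver-↾ w p)) (sym (sumOver-↾ w q)) (sum-mono-≤ (↾-mono-⊆ 0≤w p⊆q))

  sumOver-∪ : (∀ i → 0ℚ ≤ w i) → ∀ p q → sumOver w (p ∪ q) ≤ sumOver w p + sumOver w q
  sumOver-∪ 0≤w p q = subst₂ _≤_ (sym (sumOver-↾ w (p ∪ q))) (sym (sumOver-+ p q)) (sum-mono-≤ pointwise)
    where
    pointwise : ∀ i → (w ↾ (p ∪ q)) i ≤ (w ↾ p) i + (w ↾ q) i
    pointwise i with i ∈? p | i ∈? q
    ... | yes i∈p | _
      rewrite ↾-∈ w (x∈p∪q⁺ {p = p} {q} (inj₁ i∈p)) | ↾-∈ w i∈p = p≤p+q (↾-nonNeg 0≤w q i)
    ... | no i∉p | yes i∈q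
      rewrite ↾-∈ w (x∈p∪q⁺ {p = p} {q} (inj₂ i∈q)) | ↾-∉ w i∉p | ↾-∈ w i∈q = p≤q+p ℚP.≤-refl
    ... | no i∉p | no i∉q
      rewrite ↾-∉ w (λ i∈p∪q → [ i∉p , i∉q ]′ (x∈p∪q⁻ p q i∈p∪q)) | ↾-∉ w i∉p | ↾-∉ w i∉q = ℚP.≤-refl

sumOver-mono-≤ : ∀ {k} {w w′ : Fin k → ℚ} → (∀ i → w i ≤ w′ i) → ∀ p → sumOver w p ≤ sumOver w′ p
sumOver-mono-≤ w≤w′ []            = ℚP.≤-refl
sumOver-mono-≤ {w = w} {w′} w≤w′ (inside  ∷ p) =
  ℚP.+-mono-≤ (w≤w′ zero) (sumOver-mono-≤ {w = w ∘ suc} {w′ ∘ suc} (w≤w′ ∘ suc) p)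
sumOver-mono-≤ {w = w} {w′} w≤w′ (outside ∷ p) = sumOver-mono-≤ {w = w ∘ suc} {w′ ∘ suc} (w≤w′ ∘ suc) p

sumOver-∅ : ∀ {k} (w : Fin k → ℚ) → sumOver w ∅ ≡ 0ℚ
sumOver-∅ {zero}  w = refl
sumOver-∅ {suc k} w = sumOver-∅ (w ∘ suc)

sumOver-Empty : ∀ {k} (w : Fin k → ℚ) {p} → Empty p → sumOver w p ≡ 0ℚ
sumOver-Empty w p-empty = trans (cong (sumOver w) (Empty-unique p-empty)) (sumOver-∅ w)

sumOver-⁅⁆ : ∀ {k} (w : Fin k → ℚ) i → sumOver w ⁅ i ⁆ ≡ w i
sumOver-⁅⁆ w zero    = trans (cong (λ s → w zero + s) (sumOver-∅ (w ∘ suc))) (ℚP.+-identityʳ _)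
sumOver-⁅⁆ w (suc i) = sumOver-⁅⁆ (w ∘ suc) i

sumOver-full : ∀ {k} (w : Fin k → ℚ) → sumOver w (full k) ≡ sum w
sumOver-full {zero}  w = refl
sumOver-full {suc k} w = cong (λ s → w zero + s) (sumOver-full (w ∘ suc))

sumOver-*ˡ : ∀ {k} a (w : Fin k → ℚ) p → sumOver (λ i → a * w i) p ≡ a * sumOver w p
sumOver-*ˡ a w []            = sym (ℚP.*-zeroʳ a)
sumOver-*ˡ a w (inside  ∷ p) =
  trans (cong (λ s → a * w zero + s) (sumOver-*ˡ a (w ∘ suc) p)) (sym (ℚP.*-distribˡ-+ a _ _))
sumOver-*ˡ a w (outside ∷ p) = sumOver-*ˡ a (w ∘ suc) p

0<sumOver⇒Nonempty : ∀ {k} {w : Fin k → ℚ} p → 0ℚ < sumOver w p → Nonempty p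
0<sumOver⇒Nonempty []            0<0 = ⊥-elim (ℚP.<-irrefl refl 0<0)
0<sumOver⇒Nonempty (inside  ∷ p) _   = zero , here
0<sumOver⇒Nonempty (outside ∷ p) 0<s with 0<sumOver⇒Nonempty p 0<s
... | i , i∈p = suc i , there i∈p

sumOver-mono-⊂ : ∀ {k} {w : Fin k → ℚ} → (∀ i → 0ℚ < w i) →
                 ∀ {p q i} → p ⊆ q → i ∈ q → i ∉ p → sumOver w p < sumOver w q
sumOver-mono-⊂ {w = w} 0<w {p} {q} {i} p⊆q i∈q i∉p = ℚP.<-≤-trans grow
  (subst₂ _≤_ (trans (sym (sumOver-+ p ⁅ i ⁆)) (cong (λ s → sumOver w p + s) (sumOver-⁅⁆ w i)))
              (sym (sumOver-↾ w q)) (sum-mono-≤ pointwise))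
  where
  0≤w : ∀ j → 0ℚ ≤ w j
  0≤w j = ℚP.<⇒≤ (0<w j)
  grow : sumOver w p < sumOver w p + w i
  grow = subst (_< sumOver w p + w i) (ℚP.+-identityʳ _) (ℚP.+-monoʳ-< (sumOver w p) (0<w i))
  pointwise : ∀ j → (w ↾ p) j + (w ↾ ⁅ i ⁆) j ≤ (w ↾ q) j
  pointwise j with j ∈? p
  ... | yes j∈p rewrite ↾-∉ w (λ j∈⁅i⁆ → i∉p (subst (_∈ p) (x∈⁅y⁆⇒x≡y i j∈⁅i⁆) j∈p))
                      | ↾-∈ w j∈p | ↾-∈ w (p⊆q j∈p) = ℚP.≤-reflexive (ℚP.+-identityʳ _)
  ... | no  j∉p rewrite ↾-∉ w j∉p =
    subst (_≤ (w ↾ q) j) (sym (ℚP.+-identityˡ _))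
      (↾-mono-⊆ 0≤w (λ x∈⁅i⁆ → subst (_∈ q) (sym (x∈⁅y⁆⇒x≡y i x∈⁅i⁆)) i∈q) j)

sumOver-≤-cover : ∀ {k m} {w : Fin k → ℚ} {p : Subset k} {F : Subset m} {q : Fin m → Subset k} →
                  (∀ i → 0ℚ ≤ w i) → (∀ {i} → i ∈ p → ∃ λ j → j ∈ F × i ∈ q j) →
                  sumOver w p ≤ sumOver (λ j → sumOver w (q j)) F
sumOver-≤-cover {k} {m} {w} {p} {F} {q} 0≤w cover = begin
  sumOver w p                                           ≡⟨ sumOver-↾ w p ⟩
  sum (w ↾ p)                                           ≤⟨ sum-mono-≤ pointwise ⟩
  sum (λ i → sum (λ j → term j i))                      ≡⟨ ∑-comm (λ i j → term j i) ⟩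
  sum (λ j → sum (term j))                              ≡⟨ sum-cong-≗ sum-term ⟩
  sum ((λ j → sumOver w (q j)) ↾ F)                     ≡⟨ sumOver-↾ _ F ⟨
  sumOver (λ j → sumOver w (q j)) F                     ∎
  where
  open ℚP.≤-Reasoning
  term : Fin m → Fin k → ℚ
  term j i = ((λ j → (w ↾ q j) i) ↾ F) j
  sum-term : ∀ j → sum (term j) ≡ ((λ j → sumOver w (q j)) ↾ F) j
  sum-term j = trans (sum-if (lookup F j) (w ↾ q j))
                     (cong (λ x → if lookup F j then x else 0ℚ) (sym (sumOver-↾ w (q j))))
  0≤term : ∀ i j → 0ℚ ≤ term j i
  0≤term i = ↾-nonNeg (λ j → ↾-nonNeg 0≤w (q j) i) F
  pointwise : ∀ i → (w ↾ p) i ≤ sum (λ j → term j i)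
  pointwise i with i ∈? p
  ... | no  i∉p = subst (_≤ _) (sym (↾-∉ w i∉p)) (sum-nonNeg (0≤term i))
  ... | yes i∈p with cover i∈p
  ...   | j , j∈F , i∈qj = ℚP.≤-trans (ℚP.≤-reflexive wᵢ≡term) (≤-sum (0≤term i) j)
    where
    wᵢ≡term : (w ↾ p) i ≡ term j i
    wᵢ≡term = trans (↾-∈ w i∈p) (sym (trans (↾-∈ (λ j → (w ↾ q j) i) j∈F) (↾-∈ w i∈qj)))

*-pos : ∀ {p q} → 0ℚ < p → 0ℚ < q → 0ℚ < p * q
*-pos {p} {q} 0<p 0<q = ℚP.positive⁻¹ (p * q) {{ℚP.pos*pos⇒pos p {{positive 0<p}} q {{positive 0<q}}}}

iter-pos : ∀ k {a} → 0ℚ < a → 0ℚ < iter k a 1ℚ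
iter-pos zero    0<a = ℚP.positive⁻¹ 1ℚ
iter-pos (suc k) 0<a = *-pos 0<a (iter-pos k 0<a)

pow2-pos : ∀ z → 0ℚ < pow2 z
pow2-pos (+ k)    = iter-pos k (ℚP.positive⁻¹ two)
pow2-pos -[1+ k ] = iter-pos (suc k) (ℚP.positive⁻¹ half)

pow2-nonNeg : ∀ z → 0ℚ ≤ pow2 z
pow2-nonNeg z = ℚP.<⇒≤ (pow2-pos z)

pow2*-monoˡ-≤ : ∀ z {p q} → p ≤ q → pow2 z * p ≤ pow2 z * q
pow2*-monoˡ-≤ z = ℚP.*-monoˡ-≤-nonNeg (pow2 z) {{nonNegative (pow2-nonNeg z)}}

pow2-suc : ∀ z → pow2 (ℤ.suc z) ≡ two * pow2 z
pow2-suc (+ k)          = refl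
pow2-suc -[1+ zero ]    = refl
pow2-suc -[1+ suc k ]   =
  sym (trans (sym (ℚP.*-assoc two half (pow2 -[1+ k ]))) (ℚP.*-identityˡ (pow2 -[1+ k ])))

pow2-pred : ∀ z → pow2 (ℤ.pred z) ≡ half * pow2 z
pow2-pred z = begin
  pow2 (ℤ.pred z)                    ≡⟨ ℚP.*-identityˡ (pow2 (ℤ.pred z)) ⟨
  (half * two) * pow2 (ℤ.pred z)     ≡⟨ ℚP.*-assoc half two (pow2 (ℤ.pred z)) ⟩
  half * (two * pow2 (ℤ.pred z))     ≡⟨ cong (half *_) (pow2-suc (ℤ.pred z)) ⟨
  half * pow2 (ℤ.suc (ℤ.pred z))     ≡⟨ cong (λ x → half * pow2 x) (ℤP.suc-pred z) ⟩
  half * pow2 z                      ∎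
  where open ≡-Reasoning

pow2-+ : ∀ a b → pow2 (a ℤ.+ b) ≡ pow2 a * pow2 b
pow2-+ a (+ zero)        = trans (cong pow2 (ℤP.+-identityʳ a)) (sym (ℚP.*-identityʳ _))
pow2-+ a (+ suc j)       = begin
  pow2 (a ℤ.+ (1ℤ ℤ.+ + j))        ≡⟨ cong pow2 (+-leftComm a 1ℤ (+ j)) ⟩
  pow2 (ℤ.suc (a ℤ.+ + j))         ≡⟨ pow2-suc (a ℤ.+ + j) ⟩
  two * pow2 (a ℤ.+ + j)           ≡⟨ cong (two *_) (pow2-+ a (+ j)) ⟩
  two * (pow2 a * pow2 (+ j))      ≡⟨ *-leftComm two (pow2 a) (pow2 (+ j)) ⟩
  pow2 a * (two * pow2 (+ j))      ∎
  where open ≡-Reasoning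
pow2-+ a -[1+ zero ]     = trans (cong pow2 (ℤP.+-comm a -1ℤ)) (trans (pow2-pred a) (ℚP.*-comm half (pow2 a)))
pow2-+ a -[1+ suc j ]    = begin
  pow2 (a ℤ.+ (-1ℤ ℤ.+ -[1+ j ]))  ≡⟨ cong pow2 (+-leftComm a -1ℤ -[1+ j ]) ⟩
  pow2 (ℤ.pred (a ℤ.+ -[1+ j ]))   ≡⟨ pow2-pred (a ℤ.+ -[1+ j ]) ⟩
  half * pow2 (a ℤ.+ -[1+ j ])     ≡⟨ cong (half *_) (pow2-+ a -[1+ j ]) ⟩
  half * (pow2 a * pow2 -[1+ j ])  ≡⟨ *-leftComm half (pow2 a) (pow2 -[1+ j ]) ⟩
  pow2 a * (half * pow2 -[1+ j ])  ∎
  where open ≡-Reasoning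

p+p≡two*p : ∀ p → p + p ≡ two * p
p+p≡two*p p =
  trans (cong₂ _+_ (sym (ℚP.*-identityˡ p)) (sym (ℚP.*-identityˡ p))) (sym (ℚP.*-distribʳ-+ p 1ℚ 1ℚ))

pow2-≤-suc : ∀ z → pow2 z ≤ pow2 (ℤ.suc z)
pow2-≤-suc z =
  subst (pow2 z ≤_) (trans (p+p≡two*p (pow2 z)) (sym (pow2-suc z))) (p≤p+q (pow2-nonNeg z))

pow2-mono-+ : ∀ a j → pow2 a ≤ pow2 (a ℤ.+ + j)
pow2-mono-+ a zero    = ℚP.≤-reflexive (cong pow2 (sym (ℤP.+-identityʳ a)))
pow2-mono-+ a (suc j) = ℚP.≤-trans (pow2-mono-+ a j)
  (subst (λ x → pow2 (a ℤ.+ + j) ≤ pow2 x) (sym (+-leftComm a 1ℤ (+ j))) (pow2-≤-suc (a ℤ.+ + j)))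

pow2-mono-≤ : ∀ {a b} → a ℤ.≤ b → pow2 a ≤ pow2 b
pow2-mono-≤ {a} {b} a≤b = subst (λ x → pow2 a ≤ pow2 x) a+∣b-a∣≡b (pow2-mono-+ a ℤ.∣ b ℤ.- a ∣)
  where
  a+[b-a]≡b : ∀ a b → a ℤ.+ (b ℤ.- a) ≡ b
  a+[b-a]≡b = solve-∀
  a+∣b-a∣≡b : a ℤ.+ + ℤ.∣ b ℤ.- a ∣ ≡ b
  a+∣b-a∣≡b = trans (cong (λ d → a ℤ.+ d) (ℤP.0≤i⇒+∣i∣≡i (ℤP.i≤j⇒0≤j-i a≤b))) (a+[b-a]≡b a b)

pow2-cancel-< : ∀ {a b} → pow2 a < pow2 b → a ℤ.< b
pow2-cancel-< {a} {b} 2^a<2^b with a ℤ.<? b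
... | yes a<b = a<b
... | no  a≮b = ⊥-elim (ℚP.<-irrefl refl (ℚP.<-≤-trans 2^a<2^b (pow2-mono-≤ (ℤP.≮⇒≥ a≮b))))

fromℕ : ℕ → ℚ
fromℕ zero    = 0ℚ
fromℕ (suc N) = 1ℚ + fromℕ N

toℚᵘ-fromℕ : ∀ N → toℚᵘ (fromℕ N) ℚᵘ.≃ ℚᵘ.mkℚᵘ (+ N) 0
toℚᵘ-fromℕ zero    = ℚᵘP.≃-refl
toℚᵘ-fromℕ (suc N) = ℚᵘP.≃-trans (ℚP.toℚᵘ-homo-+ 1ℚ (fromℕ N))
  (ℚᵘP.≃-trans (ℚᵘP.+-congʳ (toℚᵘ 1ℚ) (toℚᵘ-fromℕ N)) (ℚᵘ.*≡* (1/1+n/1≡[1+n]/1 (+ N))))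
  where
  1/1+n/1≡[1+n]/1 : ∀ n → (+ 1 ℤ.* + 1 ℤ.+ n ℤ.* + 1) ℤ.* + 1 ≡ (+ 1 ℤ.+ n) ℤ.* + 1
  1/1+n/1≡[1+n]/1 = solve-∀

≤-fromℕ∣↥∣ : ∀ q → q ≤ fromℕ ℤ.∣ ↥ q ∣
≤-fromℕ∣↥∣ q = ℚP.toℚᵘ-cancel-≤ (ℚᵘP.≤-respʳ-≃ (ℚᵘP.≃-sym (toℚᵘ-fromℕ _)) (≤-numerator q))
  where
  ≤-numerator : ∀ q → toℚᵘ q ℚᵘ.≤ ℚᵘ.mkℚᵘ (+ ℤ.∣ ↥ q ∣) 0
  ≤-numerator (mkℚ (+ N)    _ _) = ℚᵘ.*≤* (ℤP.*-monoˡ-≤-nonNeg (+ N) (ℤ.+≤+ (ℕ.s≤s ℕ.z≤n)))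
  ≤-numerator (mkℚ -[1+ _ ] _ _) = ℚᵘ.*≤* ℤ.-≤+

fromℕ≤pow2 : ∀ N → fromℕ N ≤ pow2 (+ N)
fromℕ≤pow2 zero    = ℚP.<⇒≤ (pow2-pos (+ 0))
fromℕ≤pow2 (suc N) = ℚP.≤-trans
  (ℚP.+-mono-≤ (pow2-mono-≤ {b = + N} (ℤ.+≤+ ℕ.z≤n)) (fromℕ≤pow2 N)) (ℚP.≤-reflexive (p+p≡two*p (pow2 (+ N))))

pow2-unbounded : ∀ q → ∃ λ N → q ≤ pow2 (+ N)
pow2-unbounded q = ℤ.∣ ↥ q ∣ , ℚP.≤-trans (≤-fromℕ∣↥∣ q) (fromℕ≤pow2 ℤ.∣ ↥ q ∣)

pow2-unbounded-* : ∀ q {a} → 0ℚ < a → ∃ λ N → q ≤ pow2 (+ N) * a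
pow2-unbounded-* q {a} 0<a = N , subst (_≤ pow2 (+ N) * a) q/a*a≡q
  (ℚP.*-monoʳ-≤-nonNeg a {{nonNegative (ℚP.<⇒≤ 0<a)}} q/a≤2^N)
  where
  instance
    a≢0 : NonZero a
    a≢0 = ℚP.pos⇒nonZero a {{positive 0<a}}
  N : ℕ
  N = proj₁ (pow2-unbounded (q * 1/ a))
  q/a≤2^N : q * 1/ a ≤ pow2 (+ N)
  q/a≤2^N = proj₂ (pow2-unbounded (q * 1/ a))
  q/a*a≡q : q * 1/ a * a ≡ q
  q/a*a≡q = trans (ℚP.*-assoc q (1/ a) a) (trans (cong (q *_) (ℚP.*-inverseˡ a)) (ℚP.*-identityʳ q))

module _ {c : ℚ} (0<c : 0ℚ < c) where

  isCeilLg-above : ∀ {q j k} → pow2 j * c < q → IsCeilLg q c k → j ℤ.< k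
  isCeilLg-above lo (_ , q≤) =
    pow2-cancel-< (ℚP.*-cancelʳ-<-nonNeg c {{nonNegative (ℚP.<⇒≤ 0<c)}} (ℚP.<-≤-trans lo q≤))

  isCeilLg-mono : ∀ {q q′ k k′} → q ≤ q′ → IsCeilLg q c k → IsCeilLg q′ c k′ → k ℤ.≤ k′
  isCeilLg-mono {k = k} q≤q′ (lo , _) ceil′ =
    subst (ℤ._≤ _) (1+[k-1]≡k k)
      (ℤP.i<j⇒suc[i]≤j (isCeilLg-above {j = k ℤ.- + 1} (ℚP.<-≤-trans lo q≤q′) ceil′))
    where
    1+[k-1]≡k : ∀ k → 1ℤ ℤ.+ (k ℤ.- + 1) ≡ k
    1+[k-1]≡k = solve-∀

  isCeilLg-exists : ∀ {q j} → pow2 j * c < q → ∃ (IsCeilLg q c)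
  isCeilLg-exists {q} {j} lo with pow2-unbounded-* q (*-pos (pow2-pos (1ℤ ℤ.+ j)) 0<c)
  ... | N , q≤ = search N (1ℤ ℤ.+ j) (subst (λ x → pow2 x * c < q) (sym ([1+k]-1≡k j)) lo)
    (subst (q ≤_) (2^N*[2^k*c]≡2^[k+N]*c (1ℤ ℤ.+ j)) q≤)
    where
    [1+k]-1≡k : ∀ k → (1ℤ ℤ.+ k) ℤ.- + 1 ≡ k
    [1+k]-1≡k = solve-∀
    k+[1+N]≡[1+k]+N : ∀ k n → k ℤ.+ (1ℤ ℤ.+ n) ≡ (1ℤ ℤ.+ k) ℤ.+ n
    k+[1+N]≡[1+k]+N = solve-∀
    2^N*[2^k*c]≡2^[k+N]*c : ∀ k → pow2 (+ N) * (pow2 k * c) ≡ pow2 (k ℤ.+ + N) * c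
    2^N*[2^k*c]≡2^[k+N]*c k = trans (sym (ℚP.*-assoc (pow2 (+ N)) (pow2 k) c))
      (cong (_* c) (trans (ℚP.*-comm (pow2 (+ N)) (pow2 k)) (sym (pow2-+ k (+ N)))))
    search : ∀ N k → pow2 (k ℤ.- + 1) * c < q → q ≤ pow2 (k ℤ.+ + N) * c → ∃ (IsCeilLg q c)
    search zero    k lo hi = k , lo , subst (λ x → q ≤ pow2 x * c) (ℤP.+-identityʳ k) hi
    search (suc N) k lo hi with q ℚP.≤? pow2 k * c
    ... | yes q≤ = k , lo , q≤
    ... | no  q≰ = search N (1ℤ ℤ.+ k)
      (subst (λ x → pow2 x * c < q) (sym ([1+k]-1≡k k)) (ℚP.≰⇒> q≰))
      (subst (λ x → q ≤ pow2 x * c) (k+[1+N]≡[1+k]+N k (+ N)) hi)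

module Weight (r : ℤ) where

  weight : ℤ → ℚ
  weight x = pow2 ((1ℤ ℤ.+ r) ℤ.- x)

  weight-antitone : ∀ {x y} → x ℤ.≤ y → weight y ≤ weight x
  weight-antitone x≤y = pow2-mono-≤ (ℤP.+-monoʳ-≤ (1ℤ ℤ.+ r) (ℤP.neg-mono-≤ x≤y))

  weight≤1 : ∀ {x} → r ℤ.< x → weight x ≤ 1ℚ
  weight≤1 {x} r<x = subst (weight x ≤_) (cong pow2 (ℤP.+-inverseʳ (1ℤ ℤ.+ r)))
    (weight-antitone (ℤP.i<j⇒suc[i]≤j r<x))

  two*weight-suc : ∀ x → two * weight (1ℤ ℤ.+ x) ≡ weight x
  two*weight-suc x = trans (sym (pow2-suc ((1ℤ ℤ.+ r) ℤ.- (1ℤ ℤ.+ x)))) (cong pow2 (exponent r x))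
    where
    exponent : ∀ r x → 1ℤ ℤ.+ ((1ℤ ℤ.+ r) ℤ.- (1ℤ ℤ.+ x)) ≡ (1ℤ ℤ.+ r) ℤ.- x
    exponent = solve-∀

  weight-p+p≡two*p : ∀ {x k} → x ℤ.< k → two * weight k ≤ weight x
  weight-p+p≡two*p {x} {k} x<k = subst (two * weight k ≤_) (two*weight-suc x)
    (ℚP.*-monoˡ-≤-nonNeg two (weight-antitone (ℤP.i<j⇒suc[i]≤j x<k)))

  pow2r*c≤weight*q : ∀ {k c q} → pow2 (k ℤ.- + 1) * c < q → pow2 r * c ≤ weight k * q
  pow2r*c≤weight*q {k} {c} {q} lo = subst (_≤ weight k * q) 2^[r+1-k]*[2^[k-1]*c]≡2^r*c
    (pow2*-monoˡ-≤ ((1ℤ ℤ.+ r) ℤ.- k) (ℚP.<⇒≤ lo))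
    where
    exponent : ∀ r k → ((1ℤ ℤ.+ r) ℤ.- k) ℤ.+ (k ℤ.- + 1) ≡ r
    exponent = solve-∀
    2^[r+1-k]*[2^[k-1]*c]≡2^r*c : weight k * (pow2 (k ℤ.- + 1) * c) ≡ pow2 r * c
    2^[r+1-k]*[2^[k-1]*c]≡2^r*c = trans (sym (ℚP.*-assoc (weight k) (pow2 (k ℤ.- + 1)) c))
      (cong (_* c) (trans (sym (pow2-+ ((1ℤ ℤ.+ r) ℤ.- k) (k ℤ.- + 1))) (cong pow2 (exponent r k))))

module ≤₋ = IsPreorder (≤₋-isPreorder-≡ ℤP.≤-isPreorder)

module Run (G : Hypergraph) where
  open Hypergraph G

  eff : State G → Fin n → Maybe ℤ
  eff = State.eff

  eid : State G → Fin n → Maybe (Fin m)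
  eid = State.eid

  infix 4 _≼_

  _≼_ : State G → State G → Set
  s ≼ s′ = ∀ v → eff s v ≤₋ eff s′ v

  ≼-trans : ∀ {s s′ s″} → s ≼ s′ → s′ ≼ s″ → s ≼ s″
  ≼-trans s≼s′ s′≼s″ v = ≤₋.trans (s≼s′ v) (s′≼s″ v)

  <∞⇒≤₋ : ∀ a {k} → _<∞_ G a k → a ≤₋ just k
  <∞⇒≤₋ nothing  _   = ⊥₋≤ _
  <∞⇒≤₋ (just x) x<k = [ ℤP.<⇒≤ x<k ]

  <∞-≤-trans : ∀ a {k k′} → _<∞_ G a k → k ℤ.≤ k′ → _<∞_ G a k′
  <∞-≤-trans nothing  _   _    = _
  <∞-≤-trans (just x) x<k k≤k′ = ℤP.<-≤-trans x<k k≤k′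

  ≤₋-<∞-trans : ∀ a {j k} → a ≤₋ just j → j ℤ.< k → _<∞_ G a k
  ≤₋-<∞-trans nothing  _       _   = _
  ≤₋-<∞-trans (just x) [ x≤j ] j<k = ℤP.≤-<-trans x≤j j<k

  effectiveAt-∈ : ∀ {s t T k v} → EffectiveAt G s t T k → v ∈ T →
                  IsCeilLg (bOf G T) (c t) k × _<∞_ G (eff s v) k
  effectiveAt-∈ {v = v} (inj₁ T-empty)       v∈T = ⊥-elim (T-empty (v , v∈T))
  effectiveAt-∈ {v = v} (inj₂ (ceil , below)) v∈T = ceil , below v v∈T

  update-≽ : ∀ {s t T k} → EffectiveAt G s t T k → s ≼ update G s t T k
  update-≽ {s} {t} {T} {k} effective v with v ∈? T
  ... | yes v∈T = subst (eff s v ≤₋_) (sym (if-∈ v∈T))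
    (<∞⇒≤₋ (eff s v) {k} (proj₂ (effectiveAt-∈ {s} {t} {T} {k} effective v∈T)))
  ... | no  v∉T = ≤₋.reflexive (sym (if-∉ v∉T))

  record Processed (s : State G) (o : Fin m) : Set where
    field
      before : State G
      chosen : Subset n
      level  : ℤ
      valid  : ValidChoice G before o chosen level
      later  : update G before o chosen level ≼ s

  processed : ∀ {t s} → Reach G t s → ∀ o → toℕ o ℕ.< t → Processed s o
  processed start o ()
  processed (step {t} {s} run t<m T k valid) o o<1+t with toℕ o ℕP.≟ t
  ... | yes o≡t rewrite FinP.toℕ-injective {i = o} (trans o≡t (sym (FinP.toℕ-fromℕ< t<m))) =
    record { before = s ; chosen = T ; level = k ; valid = valid ; later = λ v → ≤₋.refl }
  ... | no  o≢t = record
    { before = before ; chosen = chosen ; level = level ; valid = valid′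
    ; later  = ≼-trans {update G before o chosen level} {s} {update G s (fromℕ< t<m) T k} later
        (update-≽ {s} {fromℕ< t<m} {T} {k} (proj₁ (proj₂ valid))) }
    where open Processed (processed run o (ℕP.≤∧≢⇒< (ℕ.s≤s⁻¹ o<1+t) o≢t)) renaming (valid to valid′)

  gt∞⇒< : ∀ {x r} → gt∞ G (just x) r ≡ true → r ℤ.< x
  gt∞⇒< {x} {r} gt with r ℤ.<? x | gt
  ... | yes r<x | _ = r<x
  ... | no  _   | ()

  leq∞⇒≤₋ : ∀ a {R} → leq∞ G a R ≡ true → a ≤₋ just R
  leq∞⇒≤₋ nothing  _ = ⊥₋≤ _
  leq∞⇒≤₋ (just x) {R} leq with x ℤ.≤? R | leq
  ... | yes x≤R | _ = [ x≤R ]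
  ... | no  _   | ()

  ∈Ile⁻ : ∀ {s R v} → v ∈ Ile G s R → eff s v ≤₋ just R
  ∈Ile⁻ {s} {R} {v} v∈I = leq∞⇒≤₋ (eff s v) (trans (sym (lookup∘tabulate _ v)) ([]=⇒lookup v∈I))

  ∈Sgt⁻ : ∀ {s r e} → e ∈ Sgt G s r → ∃ λ v → gt∞ G (eff s v) r ≡ true × eid s v ≡ just e
  ∈Sgt⁻ = ∈-tabulate-⌊⌋⁻ _

  ∈Sgt⁺ : ∀ {s r e} v → gt∞ G (eff s v) r ≡ true → eid s v ≡ just e → e ∈ Sgt G s r
  ∈Sgt⁺ v gt eid≡ = ∈-tabulate-⌊⌋⁺ _ (v , gt , eid≡)

  Sgt-update : ∀ {s t T k r e} → e ∈ Sgt G (update G s t T k) r →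
               e ∈ Sgt G s r ⊎ (e ≡ t × r ℤ.< k × Nonempty T)
  Sgt-update {s} {t} {T} {k} {r} e∈ with ∈Sgt⁻ {update G s t T k} {r} e∈
  ... | v , gt , eid≡ with v ∈? T
  ...   | yes v∈T = inj₂ ( just-injective (trans (sym eid≡) (if-∈ v∈T))
                         , gt∞⇒< (subst (λ a → gt∞ G a r ≡ true) (if-∈ v∈T) gt)
                         , v , v∈T )
  ...   | no  v∉T =
    inj₁ (∈Sgt⁺ {s} {r} v (subst (λ a → gt∞ G a r ≡ true) (if-∉ v∉T) gt) (trans (sym (if-∉ v∉T)) eid≡))

  b-nonNeg : ∀ v → 0ℚ ≤ b v
  b-nonNeg v = ℚP.<⇒≤ (b-pos v)

  c-nonNeg : ∀ e → 0ℚ ≤ c e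
  c-nonNeg e = ℚP.<⇒≤ (c-pos e)

  b*-monoˡ-≤ : ∀ v {p q} → p ≤ q → b v * p ≤ b v * q
  b*-monoˡ-≤ v = ℚP.*-monoˡ-≤-nonNeg (b v) {{nonNegative (b-nonNeg v)}}

  module Charging (r : ℤ) where
    open Weight r

    potential : Maybe ℤ → ℚ
    potential nothing  = 0ℚ
    potential (just x) = 0ℚ ⊔ (two - weight x)

    potential-nonNeg : ∀ a → 0ℚ ≤ potential a
    potential-nonNeg nothing  = ℚP.≤-refl
    potential-nonNeg (just x) = ℚP.p≤p⊔q 0ℚ (two - weight x)

    potential≤2 : ∀ a → potential a ≤ two
    potential≤2 nothing  = ℚP.<⇒≤ (ℚP.positive⁻¹ two)
    potential≤2 (just x) = ℚP.⊔-lub (ℚP.<⇒≤ (ℚP.positive⁻¹ two))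
      (ℚP.+-monoʳ-≤ two (ℚP.neg-antimono-≤ (pow2-nonNeg ((1ℤ ℤ.+ r) ℤ.- x))))

    potential-mono : ∀ {a a′} → a ≤₋ a′ → potential a ≤ potential a′
    potential-mono (⊥₋≤ a′) = potential-nonNeg a′
    potential-mono [ x≤y ]  = ℚP.⊔-monoʳ-≤ 0ℚ (ℚP.+-monoʳ-≤ two (ℚP.neg-antimono-≤ (weight-antitone x≤y)))

    potential-step : ∀ a {k} → _<∞_ G a k → r ℤ.< k → potential a + weight k ≤ potential (just k)
    potential-step a {k} a<k r<k = begin
      potential a + weight k              ≤⟨ ℚP.+-monoˡ-≤ (weight k) (below a a<k) ⟩
      (two - two * weight k) + weight k   ≡⟨ 2-2w+w≡2-w (weight k) ⟩
      two - weight k                      ≤⟨ ℚP.p≤q⊔p 0ℚ _ ⟩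
      potential (just k)                  ∎
      where
      open ℚP.≤-Reasoning
      2-2w+w≡2-w : ∀ w → (two - two * w) + w ≡ two - w
      2-2w+w≡2-w = solve 1 (λ w → (con two :- con two :* w) :+ w := con two :- w) refl
      0≤2-2w : 0ℚ ≤ two - two * weight k
      0≤2-2w = ℚP.+-monoʳ-≤ two (ℚP.neg-antimono-≤ (ℚP.*-monoˡ-≤-nonNeg two (weight≤1 r<k)))
      below : ∀ a → _<∞_ G a k → potential a ≤ two - two * weight k
      below nothing  _   = 0≤2-2w
      below (just x) x<k = ℚP.⊔-lub 0≤2-2w (ℚP.+-monoʳ-≤ two (ℚP.neg-antimono-≤ (weight-p+p≡two*p x<k)))

    Φ : State G → ℚ
    Φ s = sum (λ v → b v * potential (eff s v))

    Φ-mono : ∀ {s s′} → s ≼ s′ → Φ s ≤ Φ s′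
    Φ-mono s≼s′ = sum-mono-≤ (λ v → b*-monoˡ-≤ v (potential-mono (s≼s′ v)))

    Φ≤2b : ∀ s → Φ s ≤ two * bOf G (full n)
    Φ≤2b s = begin
      sum (λ v → b v * potential (eff s v))   ≤⟨ sum-mono-≤ (λ v → b*-monoˡ-≤ v (potential≤2 (eff s v))) ⟩
      sum (λ v → b v * two)                   ≡⟨ sum-cong-≗ (λ v → ℚP.*-comm (b v) two) ⟩
      sum (λ v → two * b v)                   ≡⟨ *-distribˡ-sum two b ⟨
      two * sum b                             ≡⟨ cong (two *_) (sumOver-full b) ⟨
      two * bOf G (full n)                    ∎
      where open ℚP.≤-Reasoning

    Φ-step : ∀ {s t T k} → (∀ v → v ∈ T → _<∞_ G (eff s v) k) → r ℤ.< k →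
             Φ s + weight k * bOf G T ≤ Φ (update G s t T k)
    Φ-step {s} {t} {T} {k} below r<k = begin
      Φ s + weight k * bOf G T                ≡⟨ cong (λ x → Φ s + weight k * x) (sumOver-↾ b T) ⟩
      Φ s + weight k * sum (b ↾ T)            ≡⟨ cong (λ x → Φ s + x) (*-distribˡ-sum (weight k) (b ↾ T)) ⟩
      Φ s + sum (λ v → weight k * (b ↾ T) v)  ≡⟨ ∑-distrib-+ (λ v → b v * potential (eff s v))
                                                             (λ v → weight k * (b ↾ T) v) ⟨
      sum (λ v → b v * potential (eff s v) + weight k * (b ↾ T) v)
                                              ≤⟨ sum-mono-≤ pointwise ⟩
      Φ (update G s t T k)                    ∎
      where
      open ℚP.≤-Reasoning
      pointwise : ∀ v → b v * potential (eff s v) + weight k * (b ↾ T) v ≤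
                        b v * potential (eff (update G s t T k) v)
      pointwise v with lookup T v in v∈?T
      ... | true  = begin
        b v * potential (eff s v) + weight k * b v  ≡⟨ cong (λ x → b v * potential (eff s v) + x)
                                                            (ℚP.*-comm (weight k) (b v)) ⟩
        b v * potential (eff s v) + b v * weight k  ≡⟨ ℚP.*-distribˡ-+ (b v) _ _ ⟨
        b v * (potential (eff s v) + weight k)      ≤⟨ b*-monoˡ-≤ v (potential-step (eff s v)
                                                                       (below v (lookup⇒[]= v T v∈?T)) r<k) ⟩
        b v * potential (just k)                    ∎
      ... | false = ℚP.≤-reflexive
        (trans (cong (λ x → b v * potential (eff s v) + x) (ℚP.*-zeroʳ (weight k))) (ℚP.+-identityʳ _))

    Charged : State G → Set
    Charged s = pow2 r * cOf G (Sgt G s r) ≤ Φ s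

    charged-initial : Charged (initial G)
    charged-initial = ℚP.≤-reflexive (begin
      pow2 r * cOf G (Sgt G (initial G) r)   ≡⟨ cong (pow2 r *_) (sumOver-Empty c no-edge) ⟩
      pow2 r * 0ℚ                            ≡⟨ ℚP.*-zeroʳ (pow2 r) ⟩
      0ℚ                                     ≡⟨ sum-replicate-zero n ⟨
      sum (λ (_ : Fin n) → 0ℚ)               ≡⟨ sum-cong-≗ (λ v → sym (ℚP.*-zeroʳ (b v))) ⟩
      Φ (initial G)                          ∎)
      where
      open ≡-Reasoning
      no-edge : Empty (Sgt G (initial G) r)
      no-edge (e , e∈) with ∈Sgt⁻ {initial G} {r} e∈
      ... | _ , () , _

    charged-unchanged : ∀ {s s′} → Sgt G s′ r ⊆ Sgt G s r → s ≼ s′ → Charged s → Charged s′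
    charged-unchanged {s} {s′} S′⊆S s≼s′ charged =
      ℚP.≤-trans (pow2*-monoˡ-≤ r (sumOver-mono-⊆ c-nonNeg S′⊆S)) (ℚP.≤-trans charged (Φ-mono {s} {s′} s≼s′))

    charged-step : ∀ {s t T k} → EffectiveAt G s t T k → Charged s → Charged (update G s t T k)
    charged-step {s} {t} {T} {k} effective charged with effective | r ℤ.<? k
    ... | inj₁ T-empty | _ = charged-unchanged
      (λ e∈ → [ id , (λ (_ , _ , T-nonempty) → contradiction T-nonempty T-empty) ]′
                (Sgt-update {s} {t} {T} {k} e∈))
      (update-≽ {s} {t} {T} {k} effective) charged
    ... | inj₂ _ | no r≮k = charged-unchanged
      (λ e∈ → [ id , (λ (_ , r<k , _) → contradiction r<k r≮k) ]′ (Sgt-update {s} {t} {T} {k} e∈))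
      (update-≽ {s} {t} {T} {k} effective) charged
    ... | inj₂ (ceil , below) | yes r<k = begin
      pow2 r * cOf G S′                    ≤⟨ pow2*-monoˡ-≤ r (sumOver-mono-⊆ c-nonNeg S′⊆S∪t) ⟩
      pow2 r * cOf G (S ∪ ⁅ t ⁆)            ≤⟨ pow2*-monoˡ-≤ r (sumOver-∪ c-nonNeg S ⁅ t ⁆) ⟩
      pow2 r * (cOf G S + cOf G ⁅ t ⁆)      ≡⟨ cong (λ x → pow2 r * (cOf G S + x)) (sumOver-⁅⁆ c t) ⟩
      pow2 r * (cOf G S + c t)             ≡⟨ ℚP.*-distribˡ-+ (pow2 r) (cOf G S) (c t) ⟩
      pow2 r * cOf G S + pow2 r * c t      ≤⟨ ℚP.+-mono-≤ charged (pow2r*c≤weight*q (proj₁ ceil)) ⟩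
      Φ s + weight k * bOf G T             ≤⟨ Φ-step {s} {t} {T} {k} below r<k ⟩
      Φ (update G s t T k)                 ∎
      where
      open ℚP.≤-Reasoning
      S S′ : Subset m
      S  = Sgt G s r
      S′ = Sgt G (update G s t T k) r
      S′⊆S∪t : S′ ⊆ S ∪ ⁅ t ⁆
      S′⊆S∪t e∈ with Sgt-update {s} {t} {T} {k} e∈
      ... | inj₁ e∈S          = x∈p∪q⁺ (inj₁ e∈S)
      ... | inj₂ (refl , _)   = x∈p∪q⁺ (inj₂ (x∈⁅x⁆ t))

    charged : ∀ {t s} → Reach G t s → Charged s
    charged start                                  = charged-initial
    charged (step run _ _ _ (_ , effective , _))   = charged-step effective (charged run)

    cost-bound : ∀ {t s} → Reach G t s → pow2 r * cOf G (Sgt G s r) ≤ two * bOf G (full n)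
    cost-bound {s = s} run = ℚP.≤-trans (charged run) (Φ≤2b s)

  module EdgeBound {s} (final : FinalState G s) (R : ℤ) (o : Fin m) where
    open Processed (processed final o (FinP.toℕ<n o)) renaming (before to s₀; chosen to T; level to k)

    U : Subset n
    U = edge o ∩ Ile G s R

    effective : EffectiveAt G s₀ o T k
    effective = proj₁ (proj₂ valid)

    U-low : ∀ {v} → v ∈ U → eff s₀ v ≤₋ just R
    U-low {v} v∈U = ≤₋.trans (update-≽ {s₀} {o} {T} {k} effective v)
      (≤₋.trans (later v) (∈Ile⁻ {s} {R} (proj₂ (x∈p∩q⁻ (edge o) _ v∈U))))

    module Heavy (heavy : pow2 R * c o < bOf G U) where

      X : Subset n
      X = T ∪ U

      heavyX : pow2 R * c o < bOf G X
      heavyX = ℚP.<-≤-trans heavy (sumOver-mono-⊆ b-nonNeg (q⊆p∪q T U))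

      X-effective : ∀ {kX} → IsCeilLg (bOf G X) (c o) kX → EffectiveAt G s₀ o X kX
      X-effective {kX} ceilX = inj₂ (ceilX , below)
        where
        below : ∀ v → v ∈ X → _<∞_ G (eff s₀ v) kX
        below v v∈X with x∈p∪q⁻ T U v∈X
        ... | inj₁ v∈T = let ceilT , v<k = effectiveAt-∈ {s₀} {o} {T} {k} effective v∈T in
          <∞-≤-trans (eff s₀ v) v<k (isCeilLg-mono (c-pos o) (sumOver-mono-⊆ b-nonNeg (p⊆p∪q U)) ceilT ceilX)
        ... | inj₂ v∈U = ≤₋-<∞-trans (eff s₀ v) (U-low v∈U) (isCeilLg-above (c-pos o) {j = R} heavyX ceilX)

      X≤T : bOf G X ≤ bOf G T
      X≤T with isCeilLg-exists (c-pos o) {j = R} heavyX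
      ... | kX , ceilX = proj₂ (proj₂ valid) X X⊆o (kX , X-effective ceilX)
        where
        X⊆o : X ⊆ edge o
        X⊆o v∈X = [ proj₁ valid , (λ v∈U → proj₁ (x∈p∩q⁻ (edge o) _ v∈U)) ]′ (x∈p∪q⁻ T U v∈X)

      U⊆T : U ⊆ T
      U⊆T {v} v∈U with v ∈? T
      ... | yes v∈T = v∈T
      ... | no  v∉T = ⊥-elim (ℚP.<-irrefl refl (ℚP.<-≤-trans T<X X≤T))
        where
        T<X : bOf G T < bOf G X
        T<X = sumOver-mono-⊂ b-pos (p⊆p∪q U) (x∈p∪q⁺ (inj₂ v∈U)) v∉T

      impossible : ⊥
      impossible with 0<sumOver⇒Nonempty U (ℚP.≤-<-trans (ℚP.<⇒≤ (*-pos (pow2-pos R) (c-pos o))) heavy)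
      ... | v , v∈U = ℤP.<-irrefl refl (ℤP.<-≤-trans R<k k≤R)
        where
        v∈T : v ∈ T
        v∈T = U⊆T v∈U
        R<k : R ℤ.< k
        R<k = isCeilLg-above (c-pos o) (ℚP.<-≤-trans heavy (sumOver-mono-⊆ b-nonNeg U⊆T))
          (proj₁ (effectiveAt-∈ {s₀} {o} {T} {k} effective v∈T))
        k≤R : k ℤ.≤ R
        k≤R = [≤]-injective (≤₋.trans (subst (_≤₋ eff s v) (if-∈ v∈T) (later v))
          (∈Ile⁻ {s} {R} (proj₂ (x∈p∩q⁻ (edge o) _ v∈U))))

    edge-bound : bOf G U ≤ pow2 R * c o
    edge-bound with bOf G U ℚP.≤? pow2 R * c o
    ... | yes light = light
    ... | no  heavy = ⊥-elim (Heavy.impossible (ℚP.≰⇒> heavy))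

  cover-bound : ∀ {s F} → FinalState G s → IsEdgeCover G F → ∀ R → bOf G (Ile G s R) ≤ pow2 R * cOf G F
  cover-bound {s} {F} final cover R = begin
    bOf G (Ile G s R)                             ≤⟨ sumOver-≤-cover b-nonNeg Ile-covered ⟩
    sumOver (λ o → bOf G (edge o ∩ Ile G s R)) F  ≤⟨ sumOver-mono-≤ (EdgeBound.edge-bound final R) F ⟩
    sumOver (λ o → pow2 R * c o) F                ≡⟨ sumOver-*ˡ (pow2 R) c F ⟩
    pow2 R * cOf G F                              ∎
    where
    open ℚP.≤-Reasoning
    Ile-covered : ∀ {v} → v ∈ Ile G s R → ∃ λ o → o ∈ F × v ∈ edge o ∩ Ile G s R
    Ile-covered {v} v∈I = let o , o∈F , v∈o = cover v in o , o∈F , x∈p∩q⁺ (v∈o , v∈I)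

ε*x<y⇒x<y÷ε : ∀ {x y ε} (0<ε : 0ℚ < ε) → ε * x < y → x < _÷_ y ε {{pos⇒nonZero ε {{positive 0<ε}}}}
ε*x<y⇒x<y÷ε {x} {y} {ε} 0<ε εx<y =
  subst (_< y * 1/ ε) εx/ε≡x (ℚP.*-monoˡ-<-pos (1/ ε) {{ℚP.1/pos⇒pos ε}} εx<y)
  where
  instance
    ε-positive : Positive ε
    ε-positive = positive 0<ε
    ε≢0 : NonZero ε
    ε≢0 = pos⇒nonZero ε
  εx/ε≡x : ε * x * 1/ ε ≡ x
  εx/ε≡x = trans (cong (_* 1/ ε) (ℚP.*-comm ε x))
    (trans (ℚP.*-assoc x ε (1/ ε)) (trans (cong (x *_) (ℚP.*-inverseʳ ε)) (ℚP.*-identityʳ x)))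

ε*C<eight*O : ∀ {p ε B C O} → 0ℚ < p → 0ℚ < ε → 0ℚ ≤ O →
                      p * C ≤ two * B → ε * B < two * p * O → ε * C < eight * O
ε*C<eight*O {p} {ε} {B} {C} {O} 0<p 0<ε 0≤O pC≤2B εB<2pO =
  ℚP.*-cancelˡ-<-nonNeg p {{nonNegative (ℚP.<⇒≤ 0<p)}} (begin-strict
    p * (ε * C)            ≡⟨ *-leftComm p ε C ⟩
    ε * (p * C)            ≤⟨ ℚP.*-monoˡ-≤-nonNeg ε {{nonNegative (ℚP.<⇒≤ 0<ε)}} pC≤2B ⟩
    ε * (two * B)          ≡⟨ *-leftComm ε two B ⟩
    two * (ε * B)          <⟨ ℚP.*-monoʳ-<-pos two εB<2pO ⟩
    two * (two * p * O)    ≡⟨ 2[2pO]≡p[4O] p O ⟩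
    p * (two * two * O)    ≤⟨ ℚP.*-monoˡ-≤-nonNeg p {{nonNegative (ℚP.<⇒≤ 0<p)}}
                                (ℚP.*-monoʳ-≤-nonNeg O {{nonNegative 0≤O}} (ℚP.≤ᵇ⇒≤ {two * two} {eight} _)) ⟩
    p * (eight * O)        ∎)
  where
  open ℚP.≤-Reasoning
  2[2pO]≡p[4O] : ∀ p O → two * (two * p * O) ≡ p * (two * two * O)
  2[2pO]≡p[4O] = solve 2 (λ p O → con two :* (con two :* p :* O) := p :* (con two :* con two :* O)) refl

lemma4 : (G : Hypergraph) → (s : State G) → FinalState G s →
    (OPT : Subset (Hypergraph.m G)) → IsMinEdgeCover G OPT →
    (ε : ℚ) → (ε>0 : 0ℚ < ε) → ε < 1ℚ →
    (r : ℤ) →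
    bOf G (Ile G s r) ≤ ε * bOf G (full (Hypergraph.n G)) →
    (∀ r′ → r Data.Integer.< r′ → ε * bOf G (full (Hypergraph.n G)) < bOf G (Ile G s r′)) →
    cOf G (Sgt G s r) < _÷_ (eight * cOf G OPT) ε {{pos⇒nonZero ε {{positive ε>0}}}}
lemma4 G s final OPT (OPT-covers , _) ε 0<ε _ r _ r-maximal =
  ε*x<y⇒x<y÷ε 0<ε (ε*C<eight*O (pow2-pos r) 0<ε (sumOver-nonNeg c-nonNeg OPT) cost low-levels)
  where
  open Hypergraph G
  open Run G
  cost : pow2 r * cOf G (Sgt G s r) ≤ two * bOf G (full n)
  cost = Charging.cost-bound r final
  low-levels : ε * bOf G (full n) < two * pow2 r * cOf G OPT
  low-levels = ℚP.<-≤-trans (r-maximal (1ℤ ℤ.+ r) (ℤP.suc[i]≤j⇒i<j ℤP.≤-refl))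
    (subst (λ x → bOf G (Ile G s (1ℤ ℤ.+ r)) ≤ x * cOf G OPT) (pow2-suc r)
           (cover-bound final OPT-covers (1ℤ ℤ.+ r)))
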